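{- Let $G$ be a twin-free graph of diameter $2$. Then $\beta(G)\le \gamma^{\rm ID}(G)\le 2\beta(G)+2$.
   Context: All graphs are finite, simple, undirected; $N[u]$ denotes the closed neighbourhood of $u$ and $d(u,v)$ the graph distance. A graph is twin-free if no two distinct vertices $u,v$ satisfy $N[u]=N[v]$. An identifying code is a set $C$ of vertices with $N[u]\cap C\neq\emptyset$ for all $u$ and $N[u]\cap C\neq N[v]\cap C$ for all distinct $u,v$; $\gamma^{\rm ID}(G)$ is the minimum size of an identifying code. A resolving set is a set $S$ of vertices such that for all distinct $u,v$ some $x\in S$ has $d(x,u)\neq d(x,v)$; $\beta(G)$ (metric dimension) is the minimum size of a resolving set. -}

module Defs where

open import Data.Nat using (ℕ; zero; suc; _<_; _≤_)
open import Data.Fin using (Fin)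
open import Data.Fin.Subset using (Subset; _∈_; ∣_∣)
open import Data.Bool using (Bool; true)
open import Data.Product using (Σ; _×_; ∃; ∃-syntax)
open import Data.Sum using (_⊎_)
open import Data.Empty using (⊥)
open import Relation.Nullary using (¬_)
open import Relation.Binary.PropositionalEquality using (_≡_; _≢_)
open import Function.Bundles using (_⇔_)

record Graph (n : ℕ) : Set where
  field
    adj     : Fin n → Fin n → Bool
    sym     : ∀ u v → adj u v ≡ adj v u
    irrefl  : ∀ u → adj u u ≡ true → ⊥

open Graph public

module _ {n : ℕ} (G : Graph n) where

  Adj : Fin n → Fin n → Set
  Adj u v = adj G u v ≡ true

  InN : Fin n → Fin n → Set
  InN u w = (w ≡ u) ⊎ Adj u w

  TwinFree : Set
  TwinFree = ∀ u v → u ≢ v → ¬ (∀ w → InN u w ⇔ InN v w)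

  data Walk : Fin n → Fin n → ℕ → Set where
    here : ∀ {u} → Walk u u zero
    step : ∀ {u w v k} → Adj u w → Walk w v k → Walk u v (suc k)

  Dist : Fin n → Fin n → ℕ → Set
  Dist u v k = Walk u v k × (∀ j → j < k → ¬ Walk u v j)

  Diameter2 : Set
  Diameter2 = (∀ u v → ∃[ k ] (k ≤ 2 × Dist u v k)) × (∃[ u ] ∃[ v ] Dist u v 2)

  IsIdentifyingCode : Subset n → Set
  IsIdentifyingCode C =
    (∀ u → ∃[ w ] (w ∈ C × InN u w)) ×
    (∀ u v → u ≢ v → ¬ (∀ w → w ∈ C → (InN u w ⇔ InN v w)))

  IsResolvingSet : Subset n → Set
  IsResolvingSet S =
    ∀ u v → u ≢ v →
      ∃[ x ] (x ∈ S × ∃[ k ] ∃[ m ] (Dist x u k × Dist x v m × k ≢ m))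

  IsIDNumber : ℕ → Set
  IsIDNumber k = (∃[ C ] (IsIdentifyingCode C × ∣ C ∣ ≡ k)) ×
                 (∀ C → IsIdentifyingCode C → k ≤ ∣ C ∣)

  IsMetricDimension : ℕ → Set
  IsMetricDimension b = (∃[ S ] (IsResolvingSet S × ∣ S ∣ ≡ b)) ×
                        (∀ S → IsResolvingSet S → b ≤ ∣ S ∣)

module Submission where

-- Lower bound: w ∈ N[u] iff d(w,u) ≤ 1, so a code vertex separating N[u] from N[v]
-- has different distances to u and v.
-- Upper bound: in diameter 2 the distance from x to any other vertex is 1 or 2, so a
-- resolving set S already separates the closed neighbourhoods of all vertices outside S.
-- Each k ∈ S is then separated from everything with at most one extra vertex, using
-- twin-freeness; finally a separating set misses N[z] for at most one z, and adding a
-- neighbour of z makes it an identifying code of size at most 2|S| + 1.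

open import Defs
open import Data.Nat using (ℕ; zero; suc; _≤_; _+_; _*_; z≤n; s≤s)
open import Data.Nat.Properties
  using (≤-refl; ≤-reflexive; ≤-trans; ≤-pred; n≤1+n; m≤n+m; +-suc; +-comm; +-identityʳ; +-monoʳ-≤; <-cmp; module ≤-Reasoning)
open import Data.Bool using (true)
open import Data.Bool.Properties using () renaming (_≟_ to _≟ᵇ_)
open import Data.Fin using (Fin) renaming (_≟_ to _≟ᶠ_)
open import Data.Fin.Properties using (any?; all?; ¬∀⟶∃¬)
open import Data.Fin.Subset using (Subset; _∈_; _∉_; _⊆_; ∣_∣; ⁅_⁆; _∪_; _-_; inside; outside)
open import Data.Fin.Subset.Properties
  using (_∈?_; x∈⁅x⁆; p⊆p∪q; q⊆p∪q; ∪-identityʳ; x∈p∧x≢y⇒x∈p-y; x∈p⇒∣p-x∣<∣p∣)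
open import Data.Vec using (_∷_)
open import Data.Product using (_×_; _,_; proj₁; proj₂; ∃-syntax; uncurry)
open import Data.Sum using (_⊎_; inj₁; inj₂)
open import Data.Unit using (⊤; tt)
open import Data.Empty using (⊥-elim)
open import Relation.Nullary using (¬_; Dec; yes; no; ¬?)
open import Relation.Nullary.Decidable using (map′; _×-dec_; _⊎-dec_; _→-dec_)
open import Relation.Unary using (Decidable)
open import Relation.Binary using (tri<; tri≈; tri>)
open import Relation.Binary.PropositionalEquality as ≡ using (_≡_; _≢_; refl; trans; cong)
open import Function using (_∘_)
open import Function.Bundles using (_⇔_; mk⇔; Equivalence)
open import Function.Construct.Composition using (_⇔-∘_)
open import Function.Construct.Symmetry using (⇔-sym)

_⇔-dec_ : ∀ {a b} {A : Set a} {B : Set b} → Dec A → Dec B → Dec (A ⇔ B)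
a? ⇔-dec b? = map′ (uncurry mk⇔) (λ e → Equivalence.to e , Equivalence.from e)
                   ((a? →-dec b?) ×-dec (b? →-dec a?))

∣p∪⁅x⁆∣≤1+∣p∣ : ∀ {n} (p : Subset n) (x : Fin n) → ∣ p ∪ ⁅ x ⁆ ∣ ≤ suc ∣ p ∣
∣p∪⁅x⁆∣≤1+∣p∣ (s ∷ p) Fin.zero rewrite ∪-identityʳ p with s
... | inside  = n≤1+n _
... | outside = ≤-refl
∣p∪⁅x⁆∣≤1+∣p∣ (inside  ∷ p) (Fin.suc x) = s≤s (∣p∪⁅x⁆∣≤1+∣p∣ p x)
∣p∪⁅x⁆∣≤1+∣p∣ (outside ∷ p) (Fin.suc x) = ∣p∪⁅x⁆∣≤1+∣p∣ p x

≡-if-≤1⇔≤1 : ∀ {k m} → 1 ≤ k → k ≤ 2 → 1 ≤ m → m ≤ 2 → (k ≤ 1 ⇔ m ≤ 1) → k ≡ m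
≡-if-≤1⇔≤1 {1}     {1}     _ _ _ _ _ = refl
≡-if-≤1⇔≤1 {1}     {2}     _ _ _ _ e with Equivalence.to e ≤-refl
... | s≤s ()
≡-if-≤1⇔≤1 {2}     {1}     _ _ _ _ e with Equivalence.from e ≤-refl
... | s≤s ()
≡-if-≤1⇔≤1 {2}     {2}     _ _ _ _ _ = refl
≡-if-≤1⇔≤1 {suc (suc (suc _))} _ (s≤s (s≤s ())) _ _ _
≡-if-≤1⇔≤1 {_} {suc (suc (suc _))} _ _ _ (s≤s (s≤s ())) _

1+n+n≤2*n+2 : ∀ b → suc (b + b) ≤ 2 * b + 2
1+n+n≤2*n+2 b = begin
  suc (b + b)  ≤⟨ n≤1+n _ ⟩
  2 + (b + b)  ≡⟨ cong (λ x → 2 + (b + x)) (≡.sym (+-identityʳ b)) ⟩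
  2 + 2 * b    ≡⟨ +-comm 2 (2 * b) ⟩
  2 * b + 2    ∎
  where open ≤-Reasoning

module _ {n : ℕ} (G : Graph n) where

  Adj-sym : ∀ {u v} → Adj G u v → Adj G v u
  Adj-sym {u} {v} a = trans (Graph.sym G v u) a

  InN? : ∀ u w → Dec (InN G u w)
  InN? u w = (w ≟ᶠ u) ⊎-dec (adj G u w ≟ᵇ true)

  Indistinguishable : Subset n → Fin n → Fin n → Set
  Indistinguishable C u v = ∀ w → w ∈ C → (InN G u w ⇔ InN G v w)

  indistinguishable? : ∀ C u v → Dec (Indistinguishable C u v)
  indistinguishable? C u v = all? (λ w → (w ∈? C) →-dec (InN? u w ⇔-dec InN? v w))

  indistinguishable-sym : ∀ {C u v} → Indistinguishable C u v → Indistinguishable C v u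
  indistinguishable-sym i w w∈C = ⇔-sym (i w w∈C)

  indistinguishable-trans : ∀ {C u v x} →
    Indistinguishable C u v → Indistinguishable C v x → Indistinguishable C u x
  indistinguishable-trans i j w w∈C = j w w∈C ⇔-∘ i w w∈C

  separating-vertex : ∀ {C u v} → ¬ Indistinguishable C u v →
    ∃[ w ] (w ∈ C × ¬ (InN G u w ⇔ InN G v w))
  separating-vertex {C} {u} {v} ¬i
    with ¬∀⟶∃¬ n _ (λ w → (w ∈? C) →-dec (InN? u w ⇔-dec InN? v w)) ¬i
  ... | w , ¬sep with w ∈? C
  ...   | yes w∈C = w , w∈C , λ e → ¬sep (λ _ → e)
  ...   | no  w∉C = ⊥-elim (¬sep (⊥-elim ∘ w∉C))

  Separates : Subset n → (Fin n → Set) → Set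
  Separates C P = ∀ u v → P u → P v → u ≢ v → ¬ Indistinguishable C u v

  separates-mono : ∀ {C C' P} → C ⊆ C' → Separates C P → Separates C' P
  separates-mono C⊆C' sep u v pu pv u≢v i = sep u v pu pv u≢v (λ w → i w ∘ C⊆C')

  separates-insert : ∀ {C P} k → Separates C P →
    (∀ u → P u → u ≢ k → ¬ Indistinguishable C u k) →
    Separates C (λ x → P x ⊎ x ≡ k)
  separates-insert k sep new u v (inj₁ pu)   (inj₁ pv)   u≢v = sep u v pu pv u≢v
  separates-insert k sep new u v (inj₁ pu)   (inj₂ refl) u≢v = new u pu u≢v
  separates-insert k sep new u v (inj₂ refl) (inj₁ pv)   u≢v =
    new v pv (u≢v ∘ ≡.sym) ∘ indistinguishable-sym
  separates-insert k sep new u v (inj₂ refl) (inj₂ refl) u≢v = ⊥-elim (u≢v refl)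

  Dominated : Subset n → Fin n → Set
  Dominated C u = ∃[ w ] (w ∈ C × InN G u w)

  dominated? : ∀ C u → Dec (Dominated C u)
  dominated? C u = any? (λ w → (w ∈? C) ×-dec InN? u w)

  undominated-unique : ∀ {C u v} → Separates C (λ _ → ⊤) →
    ¬ Dominated C u → ¬ Dominated C v → u ≡ v
  undominated-unique {C} {u} {v} sep ¬du ¬dv with u ≟ᶠ v
  ... | yes u≡v = u≡v
  ... | no  u≢v = ⊥-elim (sep u v tt tt u≢v λ w w∈C →
          mk⇔ (λ h → ⊥-elim (¬du (w , w∈C , h))) (λ h → ⊥-elim (¬dv (w , w∈C , h))))

  separating⇒identifyingCode : (∀ z → ∃[ y ] Adj G z y) →
    ∀ C → Separates C (λ _ → ⊤) →
    ∃[ C' ] (IsIdentifyingCode G C' × ∣ C' ∣ ≤ suc ∣ C ∣)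
  separating⇒identifyingCode neighbour C sep with all? (dominated? C)
  ... | yes dom = C , (dom , λ u v → sep u v tt tt) , n≤1+n _
  ... | no ¬dom with ¬∀⟶∃¬ n _ (dominated? C) ¬dom
  ...   | z , ¬dz with neighbour z
  ...     | y , z~y = C ∪ ⁅ y ⁆ , (dom , λ u v → sep' u v tt tt) , ∣p∪⁅x⁆∣≤1+∣p∣ C y
    where
    sep' : Separates (C ∪ ⁅ y ⁆) (λ _ → ⊤)
    sep' = separates-mono (p⊆p∪q ⁅ y ⁆) sep
    dom : ∀ u → Dominated (C ∪ ⁅ y ⁆) u
    dom u with dominated? C u
    ... | yes (w , w∈C , h) = w , p⊆p∪q ⁅ y ⁆ w∈C , h
    ... | no ¬du with undominated-unique sep ¬du ¬dz
    ...   | refl = y , q⊆p∪q C ⁅ y ⁆ (x∈⁅x⁆ y) , inj₂ z~y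

  module _ (twinFree : TwinFree G) where

    distinguishing-vertex : ∀ {u v} → u ≢ v → ∃[ w ] ¬ (InN G u w ⇔ InN G v w)
    distinguishing-vertex {u} {v} u≢v =
      ¬∀⟶∃¬ n _ (λ w → InN? u w ⇔-dec InN? v w) (twinFree u v u≢v)

    -- Two vertices of P indistinguishable from k would be indistinguishable from
    -- each other, so one vertex telling k from the first such u₀ suffices.
    separate-from : ∀ {C P} → Decidable P → Separates C P → ∀ k →
      ∃[ C' ] (∣ C' ∣ ≤ suc ∣ C ∣ × Separates C' (λ x → P x ⊎ x ≡ k))
    separate-from {C} {P} P? sep k
      with any? (λ u → P? u ×-dec ¬? (u ≟ᶠ k) ×-dec indistinguishable? C u k)
    ... | no none = C , n≤1+n _ , separates-insert k sep λ u pu u≢k i → none (u , pu , u≢k , i)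
    ... | yes (u₀ , pu₀ , u₀≢k , u₀~k) with distinguishing-vertex u₀≢k
    ...   | w , w-tells =
      C ∪ ⁅ w ⁆ , ∣p∪⁅x⁆∣≤1+∣p∣ C w ,
      separates-insert k (separates-mono C⊆C' sep) new
      where
      C⊆C' : C ⊆ C ∪ ⁅ w ⁆
      C⊆C' = p⊆p∪q ⁅ w ⁆
      new : ∀ u → P u → u ≢ k → ¬ Indistinguishable (C ∪ ⁅ w ⁆) u k
      new u pu u≢k i with u ≟ᶠ u₀
      ... | yes refl = w-tells (i w (q⊆p∪q C ⁅ w ⁆ (x∈⁅x⁆ w)))
      ... | no  u≢u₀ = sep u u₀ pu pu₀ u≢u₀
            (indistinguishable-trans (λ x → i x ∘ C⊆C') (indistinguishable-sym u₀~k))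

    separate-all : ∀ m R C → ∣ R ∣ ≤ m → Separates C (_∉ R) →
      ∃[ C' ] (∣ C' ∣ ≤ m + ∣ C ∣ × Separates C' (λ _ → ⊤))
    separate-all m R C ∣R∣≤m sep with any? (_∈? R)
    ... | no R-empty = C , m≤n+m ∣ C ∣ m ,
          λ u v _ _ → sep u v (λ u∈R → R-empty (u , u∈R)) (λ v∈R → R-empty (v , v∈R))
    separate-all zero R C ∣R∣≤0 sep | yes (k , k∈R) with ≤-trans (x∈p⇒∣p-x∣<∣p∣ k∈R) ∣R∣≤0
    ... | ()
    separate-all (suc m) R C ∣R∣≤1+m sep | yes (k , k∈R)
      with separate-from (λ x → ¬? (x ∈? R)) sep k
    ... | C₁ , ∣C₁∣≤1+∣C∣ , sep₁
      with separate-all m (R - k) C₁ (≤-pred (≤-trans (x∈p⇒∣p-x∣<∣p∣ k∈R) ∣R∣≤1+m))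
             (λ u v u∉ v∉ → sep₁ u v (outside-R-k u∉) (outside-R-k v∉))
      where
      outside-R-k : ∀ {x} → x ∉ R - k → x ∉ R ⊎ x ≡ k
      outside-R-k {x} x∉ with x ≟ᶠ k
      ... | yes x≡k = inj₂ x≡k
      ... | no  x≢k = inj₁ λ x∈R → x∉ (x∈p∧x≢y⇒x∈p-y x∈R x≢k)
    ...   | C' , ∣C'∣≤m+∣C₁∣ , sep' =
      C' , ≤-trans ∣C'∣≤m+∣C₁∣ (≤-trans (+-monoʳ-≤ m ∣C₁∣≤1+∣C∣) (≤-reflexive (+-suc m ∣ C ∣))) , sep'

  walk-length-0 : ∀ {x u} → Walk G x u 0 → x ≡ u
  walk-length-0 here = refl

  walk-first-step : ∀ {x u k} → Walk G x u (suc k) → ∃[ y ] Adj G x y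
  walk-first-step (step a _) = _ , a

  Dist-functional : ∀ {x u k m} → Dist G x u k → Dist G x u m → k ≡ m
  Dist-functional {k = k} {m} (wk , min-k) (wm , min-m) with <-cmp k m
  ... | tri< k<m _ _ = ⊥-elim (min-m k k<m wk)
  ... | tri≈ _ k≡m _ = k≡m
  ... | tri> _ _ m<k = ⊥-elim (min-k m m<k wm)

  Dist-positive : ∀ {x u k} → x ≢ u → Dist G x u k → 1 ≤ k
  Dist-positive {k = zero}  x≢u (w , _) = ⊥-elim (x≢u (walk-length-0 w))
  Dist-positive {k = suc _} _   _       = s≤s z≤n

  InN⇔Dist≤1 : ∀ {x u k} → Dist G x u k → (InN G u x ⇔ k ≤ 1)
  InN⇔Dist≤1 {k = zero} (w , _) = mk⇔ (λ _ → z≤n) (λ _ → inj₁ (walk-length-0 w))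
  InN⇔Dist≤1 {k = suc zero} (step x~u here , _) = mk⇔ (λ _ → ≤-refl) (λ _ → inj₂ (Adj-sym x~u))
  InN⇔Dist≤1 {x} {u} {suc (suc _)} (_ , minimal) = mk⇔ (⊥-elim ∘ too-far) λ { (s≤s ()) }
    where
    too-far : ¬ InN G u x
    too-far (inj₁ refl) = minimal 0 (s≤s z≤n) here
    too-far (inj₂ u~x)  = minimal 1 (s≤s (s≤s z≤n)) (step (Adj-sym u~x) here)

  identifyingCode⇒resolving : (∀ u v → ∃[ k ] Dist G u v k) →
    ∀ C → IsIdentifyingCode G C → IsResolvingSet G C
  identifyingCode⇒resolving connected C (_ , separates) u v u≢v
    with separating-vertex (separates u v u≢v)
  ... | w , w∈C , w-tells with connected w u | connected w v
  ...   | k , dist-k | m , dist-m =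
    w , w∈C , k , m , dist-k , dist-m ,
    λ { refl → w-tells (⇔-sym (InN⇔Dist≤1 dist-m) ⇔-∘ InN⇔Dist≤1 dist-k) }

  Diameter2⇒connected : Diameter2 G → ∀ u v → ∃[ k ] Dist G u v k
  Diameter2⇒connected (bounded , _) u v with bounded u v
  ... | k , _ , dist = k , dist

  module _ (diameter2 : Diameter2 G) where

    Dist≤2 : ∀ {x u k} → Dist G x u k → k ≤ 2
    Dist≤2 {x} {u} dist with proj₁ diameter2 x u
    ... | k , k≤2 , dist′ rewrite Dist-functional dist dist′ = k≤2

    neighbour-towards : ∀ {z t} → z ≢ t → ∃[ y ] Adj G z y
    neighbour-towards {z} {t} z≢t with Diameter2⇒connected diameter2 z t
    ... | zero  , w , _ = ⊥-elim (z≢t (walk-length-0 w))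
    ... | suc _ , w , _ = walk-first-step w

    has-neighbour : ∀ z → ∃[ y ] Adj G z y
    has-neighbour z with proj₂ diameter2
    ... | a , b , (_ , minimal) with z ≟ᶠ a
    ...   | no  z≢a  = neighbour-towards z≢a
    ...   | yes refl = neighbour-towards {t = b} λ { refl → minimal 0 (s≤s z≤n) here }

    resolving⇒separates-outside : ∀ S → IsResolvingSet G S → Separates S (_∉ S)
    resolving⇒separates-outside S resolving u v u∉S v∉S u≢v indist
      with resolving u v u≢v
    ... | x , x∈S , k , m , dist-k , dist-m , k≢m =
      k≢m (≡-if-≤1⇔≤1 (Dist-positive (λ { refl → u∉S x∈S }) dist-k) (Dist≤2 dist-k)
                       (Dist-positive (λ { refl → v∉S x∈S }) dist-m) (Dist≤2 dist-m)
                       (InN⇔Dist≤1 dist-m ⇔-∘ (indist x x∈S ⇔-∘ ⇔-sym (InN⇔Dist≤1 dist-k))))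

    resolving⇒identifyingCode : TwinFree G → ∀ S → IsResolvingSet G S →
      ∃[ C ] (IsIdentifyingCode G C × ∣ C ∣ ≤ suc (∣ S ∣ + ∣ S ∣))
    resolving⇒identifyingCode twinFree S resolving
      with separate-all twinFree ∣ S ∣ S S ≤-refl (resolving⇒separates-outside S resolving)
    ... | C₁ , ∣C₁∣≤2∣S∣ , sep₁ with separating⇒identifyingCode has-neighbour C₁ sep₁
    ...   | C , code , ∣C∣≤1+∣C₁∣ = C , code , ≤-trans ∣C∣≤1+∣C₁∣ (s≤s ∣C₁∣≤2∣S∣)

corollary1p6 : ∀ {n} (G : Graph n) → TwinFree G → Diameter2 G →
    ∀ (γ β : ℕ) → IsIDNumber G γ → IsMetricDimension G β →
    (β ≤ γ) × (γ ≤ 2 * β + 2)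
corollary1p6 G twinFree diameter2 _ _ ((C , code , refl) , γ-minimal) ((S , resolving , refl) , β-minimal)
  with resolving⇒identifyingCode G diameter2 twinFree S resolving
... | C′ , code′ , ∣C′∣≤1+2∣S∣ =
  β-minimal C (identifyingCode⇒resolving G (Diameter2⇒connected G diameter2) C code) ,
  ≤-trans (γ-minimal C′ code′) (≤-trans ∣C′∣≤1+2∣S∣ (1+n+n≤2*n+2 ∣ S ∣))
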